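{- Let $G$ be a finite simple undirected graph with maximum degree $\Delta$. Then $$\operatorname{adim}(G) \geq \frac{2(|V(G)|-1)}{\Delta+3}.$$
   Context: For vertices $u,v$ of $G$, $d(u,v)$ is the length of a shortest path between them ($\infty$ if they lie in different components), and $d_1(u,v) := \min(d(u,v),2)$. A set $A \subseteq V(G)$ is an adjacency resolving set of $G$ if for any distinct $x,y \in V(G)$ there is $z \in A$ with $d_1(z,x) \neq d_1(z,y)$. The adjacency dimension $\operatorname{adim}(G)$ is the minimum cardinality of an adjacency resolving set of $G$. -}

module Defs where

open import Data.Nat using (ℕ; zero; suc; _⊔_; _≤_; _*_; _+_; _∸_)
open import Data.Fin using (Fin; _≟_)
open import Data.Fin.Subset using (Subset; _∈_; ∣_∣)
open import Data.Bool using (Bool; true; false; T)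
open import Data.List using (List; foldr; map; length; filter)
open import Data.List.Base using ()
open import Data.Fin.Base using ()
open import Data.Vec.Functional using ()
open import Data.List using (allFin)
open import Relation.Binary.PropositionalEquality using (_≡_)
open import Relation.Nullary using (¬_; yes; no)
open import Data.Product using (Σ; _×_; ∃)

record Graph (n : ℕ) : Set where
  field
    adj     : Fin n → Fin n → Bool
    sym     : ∀ u v → adj u v ≡ adj v u
    irrefl  : ∀ v → adj v v ≡ false

open Graph public

degree : ∀ {n} → Graph n → Fin n → ℕ
degree G v = length (filter (λ u → T? (adj G v u)) (allFin _))
  where
  open import Data.Bool.Properties using () renaming (T? to T?)

maxDegree : ∀ {n} → Graph n → ℕ
maxDegree G = foldr _⊔_ 0 (map (degree G) (allFin _))

-- d₁(u,v) = min(d(u,v),2): 0 if u = v, 1 if adjacent, 2 otherwise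
d₁ : ∀ {n} → Graph n → Fin n → Fin n → ℕ
d₁ G u v with u ≟ v
... | yes _ = 0
... | no _ with adj G u v
...   | true  = 1
...   | false = 2

IsAdjResolving : ∀ {n} → Graph n → Subset n → Set
IsAdjResolving {n} G A =
  ∀ (x y : Fin n) → ¬ (x ≡ y) → ∃ λ z → z ∈ A × ¬ (d₁ G z x ≡ d₁ G z y)

IsAdim : ∀ {n} → Graph n → ℕ → Set
IsAdim G k =
  (Σ _ λ A → IsAdjResolving G A × ∣ A ∣ ≡ k) ×
  (∀ A → IsAdjResolving G A → k ≤ ∣ A ∣)

-- If A is an adjacency resolving set, every vertex outside A is determined by
-- its set of neighbours in A. So at most one outside vertex has no neighbour
-- in A, and each u ∈ A is the only A-neighbour of at most one outside vertex;
-- all other outside vertices have at least two neighbours in A. Counting the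
-- edges between A and its complement, which number at most |A| Δ, gives
-- 2 (n − |A|) ≤ |A| Δ + |A| + 2.
{-# OPTIONS --safe #-}
module Submission where

open import Defs hiding (sym)
open import Data.Bool using (Bool; true; false; not; _∧_)
open import Data.Bool.Properties using (T?; ∧-conicalˡ; ∧-conicalʳ; ∧-zeroʳ; ¬-not; T-≡)
open import Data.Fin using (Fin; zero; suc; _≟_)
open import Data.Fin.Properties using (suc-injective)
open import Data.Fin.Subset using (Subset; ∣_∣)
open import Data.List using (foldr; map; length; filter; tabulate)
open import Data.Nat using (ℕ; zero; suc; _+_; _*_; _∸_; _≤_; _⊔_; _≡ᵇ_; z≤n; s≤s)
open import Data.Nat.Properties
  using (+-*-semiring; +-comm; ≤-refl; ≤-reflexive; ≤-trans; +-mono-≤; +-monoˡ-≤; *-monoʳ-≤;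
         m≤m+n; m≤n+m; m≤m⊔n; m≤n⊔m; m≤n+o⇒m∸n≤o; ≡ᵇ⇒≡; *-distribˡ-+; *-distribˡ-∸;
         module ≤-Reasoning)
open import Algebra.Properties.Semiring.Sum +-*-semiring
  using (sum; sum-syntax; ∑-comm; ∑-distrib-+; *-distribˡ-sum; *-distribʳ-sum;
         sum-cong-≗; sum-replicate-zero)
open import Data.Nat.Tactic.RingSolver using (solve-∀)
open import Data.Product using (_×_; _,_; proj₂)
open import Data.Vec using ([]; _∷_; lookup)
open import Data.Vec.Functional using (Vector)
open import Data.Vec.Properties using ([]=⇒lookup)
open import Function using (_∘_; Equivalence)
open import Relation.Binary.PropositionalEquality
  using (_≡_; _≢_; refl; sym; trans; cong; cong₂; subst; module ≡-Reasoning)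
open import Relation.Nullary using (yes; no; contradiction)
open import Relation.Nullary.Decidable using (decidable-stable)

⟦_⟧ : Bool → ℕ
⟦ true ⟧ = 1
⟦ false ⟧ = 0

⟦∧⟧≡* : ∀ x y → ⟦ x ∧ y ⟧ ≡ ⟦ x ⟧ * ⟦ y ⟧
⟦∧⟧≡* true true = refl
⟦∧⟧≡* true false = refl
⟦∧⟧≡* false y = refl

sum-mono-≤ : ∀ {n} {f g : Vector ℕ n} → (∀ i → f i ≤ g i) → sum f ≤ sum g
sum-mono-≤ {zero} f≤g = z≤n
sum-mono-≤ {suc n} f≤g = +-mono-≤ (f≤g zero) (sum-mono-≤ (f≤g ∘ suc))

≤-sum : ∀ {n} (f : Vector ℕ n) i → f i ≤ sum f
≤-sum f zero = m≤m+n _ _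
≤-sum f (suc i) = ≤-trans (≤-sum (f ∘ suc) i) (m≤n+m _ _)

+-≤-sum : ∀ {n} (f : Vector ℕ n) {i j} → i ≢ j → f i + f j ≤ sum f
+-≤-sum f {zero} {zero} i≢j = contradiction refl i≢j
+-≤-sum f {zero} {suc j} i≢j = +-mono-≤ ≤-refl (≤-sum (f ∘ suc) j)
+-≤-sum f {suc i} {zero} i≢j =
  ≤-trans (≤-reflexive (+-comm (f (suc i)) (f zero))) (+-mono-≤ ≤-refl (≤-sum (f ∘ suc) i))
+-≤-sum f {suc i} {suc j} i≢j = ≤-trans (+-≤-sum (f ∘ suc) (i≢j ∘ cong suc)) (m≤n+m _ _)

sum-ones : ∀ n → ∑[ i < n ] 1 ≡ n
sum-ones zero = refl
sum-ones (suc n) = cong suc (sum-ones n)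

sum-⟦⟧≤1 : ∀ {n} (p : Vector Bool n) →
  (∀ i j → p i ≡ true → p j ≡ true → i ≡ j) → ∑[ i < n ] ⟦ p i ⟧ ≤ 1
sum-⟦⟧≤1 {zero} p unique = z≤n
sum-⟦⟧≤1 {suc n} p unique with p zero in p₀
... | false = sum-⟦⟧≤1 (p ∘ suc) (λ i j pᵢ pⱼ → suc-injective (unique _ _ pᵢ pⱼ))
... | true = s≤s (≤-reflexive (trans (sum-cong-≗ others-false) (sum-replicate-zero n)))
  where
  others-false : ∀ i → ⟦ p (suc i) ⟧ ≡ 0
  others-false i with p (suc i) in pᵢ
  ... | false = refl
  ... | true with () ← unique zero (suc i) p₀ pᵢ

length-filter-tabulate : ∀ {a} {A : Set a} {m} (p : A → Bool) (h : Fin m → A) →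
  length (filter (T? ∘ p) (tabulate h)) ≡ ∑[ i < m ] ⟦ p (h i) ⟧
length-filter-tabulate {m = zero} p h = refl
length-filter-tabulate {m = suc m} p h with p (h zero)
... | true = cong suc (length-filter-tabulate p (h ∘ suc))
... | false = length-filter-tabulate p (h ∘ suc)

≤-foldr-⊔-tabulate : ∀ {a} {A : Set a} {m} (d : A → ℕ) (h : Fin m → A) i →
  d (h i) ≤ foldr _⊔_ 0 (map d (tabulate h))
≤-foldr-⊔-tabulate d h zero = m≤m⊔n _ _
≤-foldr-⊔-tabulate d h (suc i) = ≤-trans (≤-foldr-⊔-tabulate d (h ∘ suc) i) (m≤n⊔m _ _)

∣∣≡sum : ∀ {n} (A : Subset n) → ∣ A ∣ ≡ ∑[ i < n ] ⟦ lookup A i ⟧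
∣∣≡sum [] = refl
∣∣≡sum (true ∷ A) = cong suc (∣∣≡sum A)
∣∣≡sum (false ∷ A) = ∣∣≡sum A

module _ {n} (G : Graph n) where

  degree≡sum : ∀ v → degree G v ≡ ∑[ u < n ] ⟦ adj G v u ⟧
  degree≡sum v = length-filter-tabulate (adj G v) (λ u → u)

  degree≤maxDegree : ∀ v → degree G v ≤ maxDegree G
  degree≤maxDegree = ≤-foldr-⊔-tabulate (degree G) (λ u → u)

  d₁-cong : ∀ {z x y} → z ≢ x → z ≢ y → adj G z x ≡ adj G z y → d₁ G z x ≡ d₁ G z y
  d₁-cong {z} {x} {y} z≢x z≢y zx≡zy with z ≟ x | z ≟ y
  ... | yes z≡x | _ = contradiction z≡x z≢x
  ... | no _ | yes z≡y = contradiction z≡y z≢y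
  ... | no _ | no _ with adj G z x | adj G z y
  ... | true | true = refl
  ... | false | false = refl
  ... | true | false with () ← zx≡zy
  ... | false | true with () ← zx≡zy

module _ {n} (G : Graph n) (A : Subset n) where

  inA : Fin n → Bool
  inA = lookup A

  A-degree : Fin n → ℕ
  A-degree v = ∑[ u < n ] ⟦ inA u ∧ adj G u v ⟧

  ⟦A-edge⟧≡1 : ∀ {u v} → inA u ≡ true → adj G u v ≡ true → ⟦ inA u ∧ adj G u v ⟧ ≡ 1
  ⟦A-edge⟧≡1 u∈A uv = cong₂ (λ a e → ⟦ a ∧ e ⟧) u∈A uv

  1≤A-degree : ∀ {u v} → inA u ≡ true → adj G u v ≡ true → 1 ≤ A-degree v
  1≤A-degree {u} {v} u∈A uv = subst (_≤ A-degree v) (⟦A-edge⟧≡1 u∈A uv) (≤-sum _ u)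

  2≤A-degree : ∀ {u z v} → u ≢ z → inA u ≡ true → adj G u v ≡ true →
    inA z ≡ true → adj G z v ≡ true → 2 ≤ A-degree v
  2≤A-degree {v = v} u≢z u∈A uv z∈A zv =
    subst (_≤ A-degree v) (cong₂ _+_ (⟦A-edge⟧≡1 u∈A uv) (⟦A-edge⟧≡1 z∈A zv)) (+-≤-sum _ u≢z)

  A-degree≡0⇒¬adj : ∀ {z v} → A-degree v ≡ 0 → inA z ≡ true → adj G z v ≡ false
  A-degree≡0⇒¬adj c≡0 z∈A =
    ¬-not λ zv → contradiction (subst (1 ≤_) c≡0 (1≤A-degree z∈A zv)) λ ()

  A-degree≡1⇒¬adj : ∀ {u z v} → A-degree v ≡ 1 → inA u ≡ true → adj G u v ≡ true →
    z ≢ u → inA z ≡ true → adj G z v ≡ false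
  A-degree≡1⇒¬adj c≡1 u∈A uv z≢u z∈A =
    ¬-not λ zv →
      contradiction (subst (2 ≤_) c≡1 (2≤A-degree (z≢u ∘ sym) u∈A uv z∈A zv)) λ { (s≤s ()) }

  A-degree≡0⇒same-adj : ∀ {x y} → A-degree x ≡ 0 → A-degree y ≡ 0 →
    ∀ z → inA z ≡ true → adj G z x ≡ adj G z y
  A-degree≡0⇒same-adj cx≡0 cy≡0 z z∈A =
    trans (A-degree≡0⇒¬adj cx≡0 z∈A) (sym (A-degree≡0⇒¬adj cy≡0 z∈A))

  A-degree≡1⇒same-adj : ∀ {u x y} → inA u ≡ true →
    A-degree x ≡ 1 → adj G u x ≡ true → A-degree y ≡ 1 → adj G u y ≡ true →
    ∀ z → inA z ≡ true → adj G z x ≡ adj G z y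
  A-degree≡1⇒same-adj {u} u∈A cx≡1 ux cy≡1 uy z z∈A with z ≟ u
  ... | yes refl = trans ux (sym uy)
  ... | no z≢u =
    trans (A-degree≡1⇒¬adj cx≡1 u∈A ux z≢u z∈A) (sym (A-degree≡1⇒¬adj cy≡1 u∈A uy z≢u z∈A))

  outside : ℕ → Fin n → Bool
  outside k v = not (inA v) ∧ (A-degree v ≡ᵇ k)

  outside-spec : ∀ {k v} → outside k v ≡ true → inA v ≡ false × A-degree v ≡ k
  outside-spec {k} {v} h with inA v
  ... | false = refl , ≡ᵇ⇒≡ (A-degree v) k (Equivalence.from T-≡ h)

  inside≢outside : ∀ {z x} → inA z ≡ true → inA x ≡ false → z ≢ x
  inside≢outside z∈A x∉A refl with () ← trans (sym z∈A) x∉A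

  outside+inside≡n : ∑[ v < n ] ⟦ not (inA v) ⟧ + ∑[ v < n ] ⟦ inA v ⟧ ≡ n
  outside+inside≡n =
    trans (sym (∑-distrib-+ (λ v → ⟦ not (inA v) ⟧) (λ v → ⟦ inA v ⟧)))
          (trans (sum-cong-≗ complementary) (sum-ones n))
    where
    complementary : ∀ v → ⟦ not (inA v) ⟧ + ⟦ inA v ⟧ ≡ 1
    complementary v with inA v
    ... | true = refl
    ... | false = refl

  sum-A-degree≤∣A∣Δ : ∑[ v < n ] A-degree v ≤ (∑[ u < n ] ⟦ inA u ⟧) * maxDegree G
  sum-A-degree≤∣A∣Δ = begin
    ∑[ v < n ] ∑[ u < n ] ⟦ inA u ∧ adj G u v ⟧
      ≡⟨ ∑-comm (λ v u → ⟦ inA u ∧ adj G u v ⟧) ⟩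
    ∑[ u < n ] ∑[ v < n ] ⟦ inA u ∧ adj G u v ⟧
      ≡⟨ sum-cong-≗ factor ⟩
    ∑[ u < n ] (⟦ inA u ⟧ * degree G u)
      ≤⟨ sum-mono-≤ (λ u → *-monoʳ-≤ ⟦ inA u ⟧ (degree≤maxDegree G u)) ⟩
    ∑[ u < n ] (⟦ inA u ⟧ * maxDegree G)
      ≡⟨ *-distribʳ-sum (maxDegree G) (λ u → ⟦ inA u ⟧) ⟨
    (∑[ u < n ] ⟦ inA u ⟧) * maxDegree G ∎
    where
    open ≤-Reasoning
    factor : ∀ u → ∑[ v < n ] ⟦ inA u ∧ adj G u v ⟧ ≡ ⟦ inA u ⟧ * degree G u
    factor u = ≡.begin
      ∑[ v < n ] ⟦ inA u ∧ adj G u v ⟧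
        ≡.≡⟨ sum-cong-≗ (λ v → ⟦∧⟧≡* (inA u) (adj G u v)) ⟩
      ∑[ v < n ] (⟦ inA u ⟧ * ⟦ adj G u v ⟧)
        ≡.≡⟨ *-distribˡ-sum ⟦ inA u ⟧ (λ v → ⟦ adj G u v ⟧) ⟨
      ⟦ inA u ⟧ * ∑[ v < n ] ⟦ adj G u v ⟧
        ≡.≡⟨ cong (⟦ inA u ⟧ *_) (degree≡sum G u) ⟨
      ⟦ inA u ⟧ * degree G u ≡.∎
      where module ≡ = ≡-Reasoning

  deficit : Fin n → ℕ
  deficit v = 2 * ⟦ outside 0 v ⟧ + ⟦ outside 1 v ⟧

  2≤A-degree+deficit : ∀ v → 2 * ⟦ not (inA v) ⟧ ≤ A-degree v + deficit v
  2≤A-degree+deficit v with inA v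
  ... | true = z≤n
  ... | false with A-degree v
  ... | zero = ≤-refl
  ... | suc zero = ≤-refl
  ... | suc (suc c) = s≤s (s≤s z≤n)

  module _ (resolving : IsAdjResolving G A) where

    outside-determined : ∀ {x y} → inA x ≡ false → inA y ≡ false →
      (∀ z → inA z ≡ true → adj G z x ≡ adj G z y) → x ≡ y
    outside-determined {x} {y} x∉A y∉A same = decidable-stable (x ≟ y) λ x≢y →
      let z , z∈A , d₁≢ = resolving x y x≢y
          z∈A′ = []=⇒lookup z∈A
      in d₁≢ (d₁-cong G (inside≢outside z∈A′ x∉A) (inside≢outside z∈A′ y∉A)
                        (same z z∈A′))

    outside0-unique : ∀ x y → outside 0 x ≡ true → outside 0 y ≡ true → x ≡ y
    outside0-unique x y hx hy =
      let x∉A , cx≡0 = outside-spec hx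
          y∉A , cy≡0 = outside-spec hy
      in outside-determined x∉A y∉A (A-degree≡0⇒same-adj cx≡0 cy≡0)

    outside1-unique : ∀ {u} → inA u ≡ true → ∀ x y →
      outside 1 x ∧ adj G u x ≡ true → outside 1 y ∧ adj G u y ≡ true → x ≡ y
    outside1-unique {u} u∈A x y hx hy =
      let x∉A , cx≡1 = outside-spec (∧-conicalˡ _ (adj G u x) hx)
          y∉A , cy≡1 = outside-spec (∧-conicalˡ _ (adj G u y) hy)
          ux = ∧-conicalʳ (outside 1 x) (adj G u x) hx
          uy = ∧-conicalʳ (outside 1 y) (adj G u y) hy
      in outside-determined x∉A y∉A (A-degree≡1⇒same-adj u∈A cx≡1 ux cy≡1 uy)

    sum-outside0≤1 : ∑[ v < n ] ⟦ outside 0 v ⟧ ≤ 1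
    sum-outside0≤1 = sum-⟦⟧≤1 (outside 0) outside0-unique

    sum-outside1≤∣A∣ : ∑[ v < n ] ⟦ outside 1 v ⟧ ≤ ∑[ u < n ] ⟦ inA u ⟧
    sum-outside1≤∣A∣ = begin
      ∑[ v < n ] ⟦ outside 1 v ⟧        ≤⟨ sum-mono-≤ via-A-neighbour ⟩
      ∑[ v < n ] ∑[ u < n ] pendant v u ≡⟨ ∑-comm pendant ⟩
      ∑[ u < n ] ∑[ v < n ] pendant v u ≤⟨ sum-mono-≤ pendants≤1 ⟩
      ∑[ u < n ] ⟦ inA u ⟧              ∎
      where
      open ≤-Reasoning
      pendant : Fin n → Fin n → ℕ
      pendant v u = ⟦ outside 1 v ∧ (inA u ∧ adj G u v) ⟧
      via-A-neighbour : ∀ v → ⟦ outside 1 v ⟧ ≤ ∑[ u < n ] pendant v u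
      via-A-neighbour v with outside 1 v in h
      ... | false = z≤n
      ... | true = ≤-reflexive (sym (proj₂ (outside-spec h)))
      pendants≤1 : ∀ u → ∑[ v < n ] pendant v u ≤ ⟦ inA u ⟧
      pendants≤1 u with inA u in u∈A
      ... | false = ≤-reflexive (trans (sum-cong-≗ λ v → cong ⟦_⟧ (∧-zeroʳ (outside 1 v)))
                                       (sum-replicate-zero n))
      ... | true = sum-⟦⟧≤1 _ (outside1-unique u∈A)

    sum-deficit≤2+∣A∣ : ∑[ v < n ] deficit v ≤ 2 + ∑[ u < n ] ⟦ inA u ⟧
    sum-deficit≤2+∣A∣ = begin
      ∑[ v < n ] (2 * ⟦ outside 0 v ⟧ + ⟦ outside 1 v ⟧)
        ≡⟨ ∑-distrib-+ (λ v → 2 * ⟦ outside 0 v ⟧) (λ v → ⟦ outside 1 v ⟧) ⟩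
      ∑[ v < n ] (2 * ⟦ outside 0 v ⟧) + ∑[ v < n ] ⟦ outside 1 v ⟧
        ≡⟨ cong (_+ ∑[ v < n ] ⟦ outside 1 v ⟧)
                (*-distribˡ-sum 2 (λ v → ⟦ outside 0 v ⟧)) ⟨
      2 * ∑[ v < n ] ⟦ outside 0 v ⟧ + ∑[ v < n ] ⟦ outside 1 v ⟧
        ≤⟨ +-mono-≤ (*-monoʳ-≤ 2 sum-outside0≤1) sum-outside1≤∣A∣ ⟩
      2 + ∑[ u < n ] ⟦ inA u ⟧ ∎
      where open ≤-Reasoning

    2*∣outside∣≤ : 2 * ∑[ v < n ] ⟦ not (inA v) ⟧
      ≤ (∑[ u < n ] ⟦ inA u ⟧) * maxDegree G + (2 + ∑[ u < n ] ⟦ inA u ⟧)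
    2*∣outside∣≤ = begin
      2 * ∑[ v < n ] ⟦ not (inA v) ⟧         ≡⟨ *-distribˡ-sum 2 (λ v → ⟦ not (inA v) ⟧) ⟩
      ∑[ v < n ] (2 * ⟦ not (inA v) ⟧)       ≤⟨ sum-mono-≤ 2≤A-degree+deficit ⟩
      ∑[ v < n ] (A-degree v + deficit v)     ≡⟨ ∑-distrib-+ A-degree deficit ⟩
      ∑[ v < n ] A-degree v + ∑[ v < n ] deficit v
        ≤⟨ +-mono-≤ sum-A-degree≤∣A∣Δ sum-deficit≤2+∣A∣ ⟩
      (∑[ u < n ] ⟦ inA u ⟧) * maxDegree G + (2 + ∑[ u < n ] ⟦ inA u ⟧) ∎
      where open ≤-Reasoning

counting-bound : ∀ {n N K Δ} → N + K ≡ n → 2 * N ≤ K * Δ + (2 + K) →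
  2 * (n ∸ 1) ≤ K * (Δ + 3)
counting-bound {N = N} {K} {Δ} refl 2N≤ = begin
  2 * (N + K ∸ 1)  ≡⟨ *-distribˡ-∸ 2 (N + K) 1 ⟩
  2 * (N + K) ∸ 2  ≤⟨ m≤n+o⇒m∸n≤o (2 * (N + K)) 2 2*[N+K]≤ ⟩
  K * (Δ + 3)      ∎
  where
  open ≤-Reasoning
  rearrange : ∀ K Δ → K * Δ + (2 + K) + 2 * K ≡ 2 + K * (Δ + 3)
  rearrange = solve-∀
  2*[N+K]≤ : 2 * (N + K) ≤ 2 + K * (Δ + 3)
  2*[N+K]≤ = begin
    2 * (N + K)              ≡⟨ *-distribˡ-+ 2 N K ⟩
    2 * N + 2 * K            ≤⟨ +-monoˡ-≤ (2 * K) 2N≤ ⟩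
    K * Δ + (2 + K) + 2 * K  ≡⟨ rearrange K Δ ⟩
    2 + K * (Δ + 3)          ∎

resolving⇒bound : ∀ {n} (G : Graph n) (A : Subset n) → IsAdjResolving G A →
  2 * (n ∸ 1) ≤ ∣ A ∣ * (maxDegree G + 3)
resolving⇒bound {n} G A resolving rewrite ∣∣≡sum A =
  counting-bound {K = ∑[ u < n ] ⟦ lookup A u ⟧}
    (outside+inside≡n G A) (2*∣outside∣≤ G A resolving)

theorem1p13 : ∀ (n : ℕ) (G : Graph n) (k : ℕ) → IsAdim G k →
    2 * (n ∸ 1) ≤ k * (maxDegree G + 3)
theorem1p13 n G k ((A , resolving , refl) , _) = resolving⇒bound G A resolving
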